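{- Let $G$ be a graph of type 1. Then $\chi_D(G\cup G)=\chi_D(G)+1$.
   Context: $G\cup G$ is the disjoint union of two copies of $G$. A distinguishing $k$-coloring of a graph is a partition of its vertex set into exactly $k$ non-empty independent sets such that only the identity automorphism maps every class onto itself; $\chi_D$ is the least such $k$. A graph is uniquely distinguishing colorable if there is exactly one partition of its vertex set into $\chi_D$ classes forming a distinguishing coloring. A connected uniquely distinguishing colorable graph $G$ is of type 1 if, whenever the two components of $G\cup G$ are each colored by the unique optimal partition with arbitrary bijective assignments of the labels $1,\dots,\chi_D(G)$ to its classes, there is an isomorphism from one component onto the other preserving all labels; otherwise it is of type 2. -}

module Defs where

open import Data.Nat using (ℕ; zero; suc; _+_; _<_; _≥_)
open import Data.Fin using (Fin; splitAt)
open import Data.Bool using (Bool; true; false)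
open import Data.Sum using (_⊎_; inj₁; inj₂)
open import Data.Product using (Σ; ∃; _×_; _,_)
open import Data.Empty using (⊥)
open import Relation.Nullary using (¬_)
open import Relation.Binary.PropositionalEquality using (_≡_; _≢_; refl)
open import Function.Bundles using (_⇔_)

record Graph : Set where
  field
    size   : ℕ
    adj    : Fin size → Fin size → Bool
    sym    : ∀ u v → adj u v ≡ adj v u
    irrefl : ∀ u → adj u u ≡ false
open Graph public

⊎adj : ∀ {m n} (G : Fin m → Fin m → Bool) (H : Fin n → Fin n → Bool)
     → Fin m ⊎ Fin n → Fin m ⊎ Fin n → Bool
⊎adj G H (inj₁ u) (inj₁ v) = G u v
⊎adj G H (inj₂ u) (inj₂ v) = H u v
⊎adj G H (inj₁ _) (inj₂ _) = false
⊎adj G H (inj₂ _) (inj₁ _) = false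

⊎adj-sym : ∀ {m n} (G : Fin m → Fin m → Bool) (H : Fin n → Fin n → Bool)
  → (∀ u v → G u v ≡ G v u) → (∀ u v → H u v ≡ H v u)
  → ∀ x y → ⊎adj G H x y ≡ ⊎adj G H y x
⊎adj-sym G H sG sH (inj₁ u) (inj₁ v) = sG u v
⊎adj-sym G H sG sH (inj₂ u) (inj₂ v) = sH u v
⊎adj-sym G H sG sH (inj₁ _) (inj₂ _) = refl
⊎adj-sym G H sG sH (inj₂ _) (inj₁ _) = refl

⊎adj-irrefl : ∀ {m n} (G : Fin m → Fin m → Bool) (H : Fin n → Fin n → Bool)
  → (∀ u → G u u ≡ false) → (∀ u → H u u ≡ false)
  → ∀ x → ⊎adj G H x x ≡ false
⊎adj-irrefl G H iG iH (inj₁ u) = iG u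
⊎adj-irrefl G H iG iH (inj₂ u) = iH u

_∪_ : Graph → Graph → Graph
G ∪ H = record
  { size   = size G + size H
  ; adj    = λ u v → ⊎adj (adj G) (adj H) (splitAt (size G) u) (splitAt (size G) v)
  ; sym    = λ u v → ⊎adj-sym (adj G) (adj H) (sym G) (sym H)
                       (splitAt (size G) u) (splitAt (size G) v)
  ; irrefl = λ u → ⊎adj-irrefl (adj G) (adj H) (irrefl G) (irrefl H) (splitAt (size G) u)
  }

data Reach (G : Graph) (u : Fin (size G)) : Fin (size G) → Set where
  here : Reach G u u
  step : ∀ {v w} → Reach G u v → adj G v w ≡ true → Reach G u w

Connected : Graph → Set
Connected G = (size G ≥ 1) × (∀ u v → Reach G u v)

record Automorphism (G : Graph) : Set where
  field
    fun     : Fin (size G) → Fin (size G)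
    inv     : Fin (size G) → Fin (size G)
    inv-l   : ∀ v → inv (fun v) ≡ v
    inv-r   : ∀ v → fun (inv v) ≡ v
    preserv : ∀ u v → adj G (fun u) (fun v) ≡ adj G u v
open Automorphism public

record Coloring (G : Graph) (k : ℕ) : Set where
  field
    col    : Fin (size G) → Fin k
    onto   : ∀ (a : Fin k) → ∃ λ v → col v ≡ a
    proper : ∀ u v → adj G u v ≡ true → col u ≢ col v
open Coloring public

Distinguishing : (G : Graph) {k : ℕ} → Coloring G k → Set
Distinguishing G c = ∀ (σ : Automorphism G)
  → (∀ v → col c (fun σ v) ≡ col c v) → ∀ v → fun σ v ≡ v

DistColoring : Graph → ℕ → Set
DistColoring G k = Σ (Coloring G k) (Distinguishing G)

IsChiD : Graph → ℕ → Set
IsChiD G k = DistColoring G k × (∀ m → m < k → ¬ DistColoring G m)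

SamePartition : (G : Graph) {k : ℕ} → Coloring G k → Coloring G k → Set
SamePartition G c c' = ∀ u v → (col c u ≡ col c v) ⇔ (col c' u ≡ col c' v)

UniquelyDistColorable : Graph → Set
UniquelyDistColorable G = ∃ λ k → IsChiD G k ×
  (∀ (c c' : DistColoring G k) → SamePartition G (Σ.proj₁ c) (Σ.proj₁ c'))

-- Type 1: connected, uniquely distinguishing colorable, and for any two
-- labellings c₁, c₂ of the unique optimal partition (i.e. any two distinguishing
-- χ_D(G)-colorings) there is an isomorphism G → G carrying the labels of c₁
-- to those of c₂.
Type1 : Graph → Set
Type1 G = Connected G × UniquelyDistColorable G ×
  (∀ k → IsChiD G k → ∀ (c₁ c₂ : DistColoring G k) →
     ∃ λ (φ : Automorphism G) → ∀ v → col (Σ.proj₁ c₂) (fun φ v) ≡ col (Σ.proj₁ c₁) v)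

{-# OPTIONS --safe #-}
module Submission where

-- Lower bound: restricted to either copy, a distinguishing coloring of G ∪ G is a
-- distinguishing coloring of G, so it needs at least χ_D(G) colors, and with exactly
-- χ_D(G) colors both halves use every color.  By type 1 the two halves then differ by
-- an automorphism φ of G, and exchanging the copies along φ is a non-trivial
-- automorphism of G ∪ G preserving the coloring.
-- Upper bound: color one copy with labels 0 … k-1 and the other with 1 … k.  Label 0
-- occurs only in the first copy, which is connected, so every color-preserving
-- automorphism maps each copy onto itself and is the identity there.

open import Defs hiding (sym)
open import Data.Nat using (ℕ; zero; suc; _≤_; _<_; s≤s)
open import Data.Nat.Properties using (≤-refl; ≤-trans; <⇒≤; <⇒≱; ≮⇒≥; m<1+n⇒m<n∨m≡n)
open import Data.Fin as Fin using (Fin; splitAt; join; inject₁; punchOut; fromℕ<; _≟_)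
open import Data.Fin.Properties
  using (splitAt-join; join-splitAt; inject₁-injective; suc-injective; punchOut-injective; all?; any?; ¬∀⟶∃¬)
open import Data.Bool using (Bool; true)
open import Data.Sum as Sum using (_⊎_; inj₁; inj₂; [_,_]′)
open import Data.Sum.Properties using (inj₁-injective; inj₂-injective; swap-involutive)
open import Data.Product using (∃; _×_; _,_; proj₁; proj₂)
open import Data.Empty using (⊥-elim)
open import Relation.Nullary using (¬_; yes; no)
open import Relation.Binary.PropositionalEquality
  using (_≡_; _≢_; refl; sym; trans; cong; cong₂; module ≡-Reasoning)
open import Function using (_∘_; case_of_)
open import Function.Definitions using (Injective)

open ≡-Reasoning

record Iso {X Y : Set} (A : X → X → Bool) (B : Y → Y → Bool) : Set where
  field
    to        : X → Y
    from      : Y → X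
    from∘to   : ∀ x → from (to x) ≡ x
    to∘from   : ∀ y → to (from y) ≡ y
    preserves : ∀ x x′ → B (to x) (to x′) ≡ A x x′
open Iso public

Aut : {X : Set} → (X → X → Bool) → Set
Aut A = Iso A A

module _ {X Y : Set} {A : X → X → Bool} {B : Y → Y → Bool} where

  infix 30 _⁻¹ᴵ

  _⁻¹ᴵ : Iso A B → Iso B A
  φ ⁻¹ᴵ = record
    { to = from φ ; from = to φ ; from∘to = to∘from φ ; to∘from = from∘to φ
    ; preserves = λ y y′ → begin
        A (from φ y) (from φ y′)                ≡⟨ preserves φ _ _ ⟨
        B (to φ (from φ y)) (to φ (from φ y′))  ≡⟨ cong₂ B (to∘from φ y) (to∘from φ y′) ⟩
        B y y′                                  ∎
    }

module _ {X Y Z : Set} {A : X → X → Bool} {B : Y → Y → Bool} {C : Z → Z → Bool} where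

  infixr 9 _∘ᴵ_

  _∘ᴵ_ : Iso B C → Iso A B → Iso A C
  ψ ∘ᴵ φ = record
    { to = to ψ ∘ to φ ; from = from φ ∘ from ψ
    ; from∘to = λ x → trans (cong (from φ) (from∘to ψ (to φ x))) (from∘to φ x)
    ; to∘from = λ z → trans (cong (to ψ) (to∘from φ (from ψ z))) (to∘from ψ z)
    ; preserves = λ x x′ → trans (preserves ψ _ _) (preserves φ x x′)
    }

idᴵ : {X : Set} {A : X → X → Bool} → Aut A
idᴵ = record { to = λ x → x ; from = λ x → x ; from∘to = λ _ → refl ; to∘from = λ _ → refl
             ; preserves = λ _ _ → refl }

Automorphism⇒Aut : ∀ {G} → Automorphism G → Aut (adj G)
Automorphism⇒Aut σ = record
  { to = fun σ ; from = inv σ ; from∘to = inv-l σ ; to∘from = inv-r σ ; preserves = preserv σ }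

Aut⇒Automorphism : ∀ {G} → Aut (adj G) → Automorphism G
Aut⇒Automorphism s = record
  { fun = to s ; inv = from s ; inv-l = from∘to s ; inv-r = to∘from s ; preserv = preserves s }

module _ {m m′ n n′ : ℕ} {A : Fin m → Fin m → Bool} {A′ : Fin m′ → Fin m′ → Bool}
         {B : Fin n → Fin n → Bool} {B′ : Fin n′ → Fin n′ → Bool} where

  infixr 8 _⊕_

  _⊕_ : Iso A A′ → Iso B B′ → Iso (⊎adj A B) (⊎adj A′ B′)
  φ ⊕ ψ = record
    { to = Sum.map (to φ) (to ψ)
    ; from = Sum.map (from φ) (from ψ)
    ; from∘to = λ { (inj₁ x) → cong inj₁ (from∘to φ x) ; (inj₂ y) → cong inj₂ (from∘to ψ y) }
    ; to∘from = λ { (inj₁ x) → cong inj₁ (to∘from φ x) ; (inj₂ y) → cong inj₂ (to∘from ψ y) }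
    ; preserves = λ where
        (inj₁ x) (inj₁ x′) → preserves φ x x′
        (inj₂ y) (inj₂ y′) → preserves ψ y y′
        (inj₁ _) (inj₂ _)  → refl
        (inj₂ _) (inj₁ _)  → refl
    }

swapᴵ : ∀ {m n} {A : Fin m → Fin m → Bool} {B : Fin n → Fin n → Bool}
      → Iso (⊎adj A B) (⊎adj B A)
swapᴵ = record
  { to = Sum.swap ; from = Sum.swap ; from∘to = swap-involutive ; to∘from = swap-involutive
  ; preserves = λ where
      (inj₁ _) (inj₁ _) → refl
      (inj₂ _) (inj₂ _) → refl
      (inj₁ _) (inj₂ _) → refl
      (inj₂ _) (inj₁ _) → refl
  }

splitAtIso : ∀ G H → Iso (adj (G ∪ H)) (⊎adj (adj G) (adj H))
splitAtIso G H = record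
  { to = splitAt (size G) ; from = join (size G) (size H)
  ; from∘to = join-splitAt (size G) (size H) ; to∘from = splitAt-join (size G) (size H)
  ; preserves = λ _ _ → refl }

module _ {X C : Set} (A : X → X → Bool) where

  ProperMap : (X → C) → Set
  ProperMap f = ∀ x y → A x y ≡ true → f x ≢ f y

  ColorPreserving : Aut A → (X → C) → Set
  ColorPreserving s f = ∀ x → f (to s x) ≡ f x

  DistinguishingMap : (X → C) → Set
  DistinguishingMap f = ∀ (s : Aut A) → ColorPreserving s f → ∀ x → to s x ≡ x

Finer : {X C C′ : Set} → (X → C′) → (X → C) → Set
Finer f′ f = ∀ x y → f′ x ≡ f′ y → f x ≡ f y

module _ {X C C′ : Set} {A : X → X → Bool} {f : X → C} {f′ : X → C′} (f′-finer : Finer f′ f) where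

  ProperMap-finer : ProperMap A f → ProperMap A f′
  ProperMap-finer proper x y e = proper x y e ∘ f′-finer x y

  DistinguishingMap-finer : DistinguishingMap A f → DistinguishingMap A f′
  DistinguishingMap-finer dist s pres = dist s (λ x → f′-finer _ _ (pres x))

ColorPreserving-⁻¹ : ∀ {X C} {A : X → X → Bool} {f : X → C} (s : Aut A)
                    → ColorPreserving A s f → ColorPreserving A (s ⁻¹ᴵ) f
ColorPreserving-⁻¹ {f = f} s pres x = trans (sym (pres (from s x))) (cong f (to∘from s x))

module _ {X Y C : Set} {A : X → X → Bool} {B : Y → Y → Bool} {f : Y → C} (φ : Iso A B) where

  ProperMap-transfer : ProperMap B f → ProperMap A (f ∘ to φ)
  ProperMap-transfer proper x y e = proper _ _ (trans (preserves φ x y) e)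

  DistinguishingMap-transfer : DistinguishingMap B f → DistinguishingMap A (f ∘ to φ)
  DistinguishingMap-transfer dist s pres x = begin
    to s x                                 ≡⟨ from∘to φ (to s x) ⟨
    from φ (to φ (to s x))                 ≡⟨ cong (from φ ∘ to φ ∘ to s) (from∘to φ x) ⟨
    from φ (to (φ ∘ᴵ s ∘ᴵ φ ⁻¹ᴵ) (to φ x)) ≡⟨ cong (from φ) (dist (φ ∘ᴵ s ∘ᴵ φ ⁻¹ᴵ) pres′ (to φ x)) ⟩
    from φ (to φ x)                        ≡⟨ from∘to φ x ⟩
    x                                      ∎
    where
    pres′ : ColorPreserving B (φ ∘ᴵ s ∘ᴵ φ ⁻¹ᴵ) f
    pres′ y = trans (pres (from φ y)) (cong f (to∘from φ y))

DistColoring⇒DistinguishingMap : ∀ {G k} ((c , _) : DistColoring G k)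
  → DistinguishingMap (adj G) (col c)
DistColoring⇒DistinguishingMap (_ , dist) s = dist (Aut⇒Automorphism s)

toDistColoring : ∀ {K m} (f : Fin (size K) → Fin m) → (∀ a → ∃ λ v → f v ≡ a)
  → ProperMap (adj K) f → DistinguishingMap (adj K) f → DistColoring K m
toDistColoring f onto proper dist =
  record { col = f ; onto = onto ; proper = proper } , λ σ → dist (Automorphism⇒Aut σ)

_∈-image_ : {X Y : Set} → X → (Y → X) → Set
x ∈-image ι = ∃ λ y → x ≡ ι y

ImageClosed : {X Y : Set} → (X → X) → (Y → X) → Set
ImageClosed f ι = ∀ y → f (ι y) ∈-image ι

module _ {X Y : Set} {A : X → X → Bool} {B : Y → Y → Bool}
         (s : Aut A) (ι : Y → X) (ι-injective : Injective _≡_ _≡_ ι)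
         (ι-adj : ∀ y y′ → A (ι y) (ι y′) ≡ B y y′)
         (closed : ImageClosed (to s) ι) (closed⁻¹ : ImageClosed (from s) ι) where

  private
    inverse-on-image : (f g : X → X) (cf : ImageClosed f ι) (cg : ImageClosed g ι)
      → (∀ x → g (f x) ≡ x) → ∀ y → proj₁ (cg (proj₁ (cf y))) ≡ y
    inverse-on-image f g cf cg g∘f y = ι-injective (begin
      ι (proj₁ (cg (proj₁ (cf y))))  ≡⟨ proj₂ (cg _) ⟨
      g (ι (proj₁ (cf y)))           ≡⟨ cong g (proj₂ (cf y)) ⟨
      g (f (ι y))                    ≡⟨ g∘f (ι y) ⟩
      ι y                            ∎)

  restrict : Aut B
  restrict = record
    { to = proj₁ ∘ closed
    ; from = proj₁ ∘ closed⁻¹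
    ; from∘to = inverse-on-image (to s) (from s) closed closed⁻¹ (from∘to s)
    ; to∘from = inverse-on-image (from s) (to s) closed⁻¹ closed (to∘from s)
    ; preserves = λ y y′ → begin
        B (proj₁ (closed y)) (proj₁ (closed y′))          ≡⟨ ι-adj _ _ ⟨
        A (ι (proj₁ (closed y))) (ι (proj₁ (closed y′)))  ≡⟨ cong₂ A (proj₂ (closed y)) (proj₂ (closed y′)) ⟨
        A (to s (ι y)) (to s (ι y′))                      ≡⟨ preserves s (ι y) (ι y′) ⟩
        A (ι y) (ι y′)                                    ≡⟨ ι-adj y y′ ⟩
        B y y′                                            ∎
    }

  closed-image-fixed : ∀ {C} {D : X → C} → ColorPreserving A s D → DistinguishingMap B (D ∘ ι)
    → ∀ y → to s (ι y) ≡ ι y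
  closed-image-fixed {D = D} pres dist y = begin
    to s (ι y)           ≡⟨ proj₂ (closed y) ⟩
    ι (to restrict y)    ≡⟨ cong ι (dist restrict restrict-preserves y) ⟩
    ι y                  ∎
    where
    restrict-preserves : ColorPreserving B restrict (D ∘ ι)
    restrict-preserves y′ = trans (cong D (sym (proj₂ (closed y′)))) (pres (ι y′))

module _ {m n : ℕ} {A : Fin m → Fin m → Bool} {B : Fin n → Fin n → Bool} where

  inj₁-image-step : ∀ {x y} → ⊎adj A B x y ≡ true → x ∈-image inj₁ → y ∈-image inj₁
  inj₁-image-step {y = inj₁ v}               _  _       = v , refl
  inj₁-image-step {x = inj₁ _} {y = inj₂ _} () _
  inj₁-image-step {x = inj₂ _}               _  (_ , ())

  inj₁-anchored : ∀ {C} {D : Fin m ⊎ Fin n → C} (s : Aut (⊎adj A B)) → ColorPreserving (⊎adj A B) s D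
    → (v₀ : Fin m) → (∀ w → D (inj₂ w) ≢ D (inj₁ v₀)) → to s (inj₁ v₀) ∈-image inj₁
  inj₁-anchored s pres v₀ unique with to s (inj₁ v₀) | pres (inj₁ v₀)
  ... | inj₁ v | _    = v , refl
  ... | inj₂ w | D-eq = ⊥-elim (unique w D-eq)

  inj₂-closed : (s : Aut (⊎adj A B)) → ImageClosed (from s) inj₁ → ImageClosed (to s) inj₂
  inj₂-closed s closed⁻¹ w with to s (inj₂ w) in eq
  ... | inj₂ w′ = w′ , refl
  ... | inj₁ v with closed⁻¹ v
  ...   | v′ , from-v≡v′ = case sides-clash of λ ()
    where
    sides-clash : inj₂ w ≡ inj₁ v′
    sides-clash = begin
      inj₂ w                   ≡⟨ from∘to s (inj₂ w) ⟨
      from s (to s (inj₂ w))   ≡⟨ cong (from s) eq ⟩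
      from s (inj₁ v)          ≡⟨ from-v≡v′ ⟩
      inj₁ v′                  ∎

  DistinguishingMap-inj₁ : ∀ {C} {D : Fin m ⊎ Fin n → C}
    → DistinguishingMap (⊎adj A B) D → DistinguishingMap A (D ∘ inj₁)
  DistinguishingMap-inj₁ {D = D} dist τ pres v = inj₁-injective (dist (τ ⊕ idᴵ) pres′ (inj₁ v))
    where
    pres′ : ColorPreserving (⊎adj A B) (τ ⊕ idᴵ) D
    pres′ = λ { (inj₁ v′) → pres v′ ; (inj₂ _) → refl }

  DistinguishingMap-inj₂ : ∀ {C} {D : Fin m ⊎ Fin n → C}
    → DistinguishingMap (⊎adj A B) D → DistinguishingMap B (D ∘ inj₂)
  DistinguishingMap-inj₂ {D = D} dist τ pres w = inj₂-injective (dist (idᴵ ⊕ τ) pres′ (inj₂ w))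
    where
    pres′ : ColorPreserving (⊎adj A B) (idᴵ ⊕ τ) D
    pres′ = λ { (inj₁ _) → refl ; (inj₂ w′) → pres w′ }

Reach-transport : ∀ {G u v} (P : Fin (size G) → Set)
  → (∀ {w w′} → adj G w w′ ≡ true → P w → P w′) → Reach G u v → P u → P v
Reach-transport P along here        pu = pu
Reach-transport P along (step r e) pu = along e (Reach-transport P along r pu)

inj₁-closed : ∀ {G n} {B : Fin n → Fin n → Bool} {v₀} → (∀ u v → Reach G u v)
  → (s : Aut (⊎adj (adj G) B)) → to s (inj₁ v₀) ∈-image inj₁ → ImageClosed (to s) inj₁
inj₁-closed {v₀ = v₀} conn s anchored v =
  Reach-transport (λ u → to s (inj₁ u) ∈-image inj₁)
    (λ e → inj₁-image-step (trans (preserves s _ _) e)) (conn v₀ v) anchored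

distinguishing-⊎ : ∀ {G n C} {B : Fin n → Fin n → Bool} → (∀ u v → Reach G u v)
  → (D : Fin (size G) ⊎ Fin n → C)
  → DistinguishingMap (adj G) (D ∘ inj₁) → DistinguishingMap B (D ∘ inj₂)
  → (v₀ : Fin (size G)) → (∀ w → D (inj₂ w) ≢ D (inj₁ v₀))
  → DistinguishingMap (⊎adj (adj G) B) D
distinguishing-⊎ conn D dist₁ dist₂ v₀ unique s pres = fixed
  where
  closed₁ : ImageClosed (to s) inj₁
  closed₁ = inj₁-closed conn s (inj₁-anchored s pres v₀ unique)
  closed₁⁻¹ : ImageClosed (from s) inj₁
  closed₁⁻¹ = inj₁-closed conn (s ⁻¹ᴵ) (inj₁-anchored (s ⁻¹ᴵ) (ColorPreserving-⁻¹ s pres) v₀ unique)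
  closed₂ : ImageClosed (to s) inj₂
  closed₂ = inj₂-closed s closed₁⁻¹
  closed₂⁻¹ : ImageClosed (from s) inj₂
  closed₂⁻¹ = inj₂-closed (s ⁻¹ᴵ) closed₁
  fixed : ∀ x → to s x ≡ x
  fixed (inj₁ v) = closed-image-fixed s inj₁ inj₁-injective (λ _ _ → refl) closed₁ closed₁⁻¹ pres dist₁ v
  fixed (inj₂ w) = closed-image-fixed s inj₂ inj₂-injective (λ _ _ → refl) closed₂ closed₂⁻¹ pres dist₂ w

twins-not-distinguishing : ∀ {n C} {A : Fin n → Fin n → Bool} {D : Fin n ⊎ Fin n → C}
  → Fin n → (φ : Aut A) → (∀ v → D (inj₂ (to φ v)) ≡ D (inj₁ v))
  → ¬ DistinguishingMap (⊎adj A A) D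
twins-not-distinguishing {A = A} {D} u φ twin dist =
  case dist (swapᴵ ∘ᴵ (φ ⊕ φ ⁻¹ᴵ)) exchange-preserves (inj₁ u) of λ ()
  where
  exchange-preserves : ColorPreserving (⊎adj A A) (swapᴵ ∘ᴵ (φ ⊕ φ ⁻¹ᴵ)) D
  exchange-preserves (inj₁ v) = twin v
  exchange-preserves (inj₂ w) = trans (sym (twin (from φ w))) (cong (D ∘ inj₂) (to∘from φ w))

module _ {K : Graph} where

  distColoring-≤ : ∀ {m} (f : Fin (size K) → Fin m) → ProperMap (adj K) f
    → DistinguishingMap (adj K) f → ∃ λ j → j ≤ m × DistColoring K j
  distColoring-< : ∀ {m} (f : Fin (size K) → Fin m) → ProperMap (adj K) f
    → DistinguishingMap (adj K) f → (a : Fin m) → ¬ (∃ λ v → f v ≡ a)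
    → ∃ λ j → j < m × DistColoring K j

  distColoring-≤ {m} f proper dist with all? (λ a → any? (λ v → f v ≟ a))
  ... | yes onto = m , ≤-refl , toDistColoring f onto proper dist
  ... | no ¬onto with ¬∀⟶∃¬ m _ (λ a → any? (λ v → f v ≟ a)) ¬onto
  ...   | a , a∉f with distColoring-< f proper dist a a∉f
  ...     | j , j<m , dc = j , <⇒≤ j<m , dc

  distColoring-< {suc m} f proper dist a a∉f with distColoring-≤ f′ proper′ dist′
    where
    a≢f : ∀ v → a ≢ f v
    a≢f v a≡fv = a∉f (v , sym a≡fv)
    f′ : Fin (size K) → Fin m
    f′ v = punchOut (a≢f v)
    f′-finer : Finer f′ f
    f′-finer u v = punchOut-injective (a≢f u) (a≢f v)
    proper′ : ProperMap (adj K) f′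
    proper′ = ProperMap-finer f′-finer proper
    dist′ : DistinguishingMap (adj K) f′
    dist′ = DistinguishingMap-finer f′-finer dist
  ... | j , j≤m , dc = j , s≤s j≤m , dc

  module _ {k : ℕ} (χ : IsChiD K k) where

    χD-≤ : ∀ {m} (f : Fin (size K) → Fin m) → ProperMap (adj K) f → DistinguishingMap (adj K) f
      → k ≤ m
    χD-≤ f proper dist with distColoring-≤ f proper dist
    ... | j , j≤m , dc = ≤-trans (≮⇒≥ λ j<k → proj₂ χ j j<k dc) j≤m

    χD-surjective : (f : Fin (size K) → Fin k) → ProperMap (adj K) f
      → DistinguishingMap (adj K) f → ∀ a → ∃ λ v → f v ≡ a
    χD-surjective f proper dist a with any? (λ v → f v ≟ a)
    ... | yes a∈f = a∈f
    ... | no a∉f with distColoring-< f proper dist a a∉f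
    ...   | j , j<k , dc = ⊥-elim (proj₂ χ j j<k dc)

distColoring-∪ : ∀ {G H k} → Connected G → DistColoring G k → DistColoring H k
  → DistColoring (G ∪ H) (suc k)
distColoring-∪ {k = zero} (size≥1 , _) (c , _) _ = case col c (fromℕ< size≥1) of λ ()
distColoring-∪ {G} {H} {suc k} (_ , conn) dc@(c , _) dc′@(c′ , _) =
  toDistColoring (D ∘ splitAt (size G)) D-onto
    (ProperMap-transfer (splitAtIso G H) D-proper) (DistinguishingMap-transfer (splitAtIso G H) D-dist)
  where
  D : Fin (size G) ⊎ Fin (size H) → Fin (suc (suc k))
  D = [ inject₁ ∘ col c , Fin.suc ∘ col c′ ]′

  D-onto : ∀ a → ∃ λ u → D (splitAt (size G) u) ≡ a
  D-onto Fin.zero with onto c Fin.zero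
  ... | v , cv≡0 = join _ _ (inj₁ v) , trans (cong D (splitAt-join _ _ (inj₁ v))) (cong inject₁ cv≡0)
  D-onto (Fin.suc a) with onto c′ a
  ... | w , c′w≡a = join _ _ (inj₂ w) , trans (cong D (splitAt-join _ _ (inj₂ w))) (cong Fin.suc c′w≡a)

  D-proper : ProperMap (⊎adj (adj G) (adj H)) D
  D-proper (inj₁ u) (inj₁ v) e = proper c u v e ∘ inject₁-injective
  D-proper (inj₂ u) (inj₂ v) e = proper c′ u v e ∘ suc-injective

  v₀ : Fin (size G)
  v₀ = proj₁ (onto c Fin.zero)

  label-0-only-left : ∀ w → D (inj₂ w) ≢ D (inj₁ v₀)
  label-0-only-left w eq = case trans eq (cong inject₁ (proj₂ (onto c Fin.zero))) of λ ()

  D-dist : DistinguishingMap (⊎adj (adj G) (adj H)) D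
  D-dist = distinguishing-⊎ conn D
    (DistinguishingMap-finer (λ _ _ → inject₁-injective) (DistColoring⇒DistinguishingMap dc))
    (DistinguishingMap-finer (λ _ _ → suc-injective) (DistColoring⇒DistinguishingMap dc′))
    v₀ label-0-only-left

module _ {G H : Graph} {m : ℕ} (dc : DistColoring (G ∪ H) m) where

  ⊎-coloring : Fin (size G) ⊎ Fin (size H) → Fin m
  ⊎-coloring = col (proj₁ dc) ∘ join (size G) (size H)

  ⊎-coloring-proper : ProperMap (⊎adj (adj G) (adj H)) ⊎-coloring
  ⊎-coloring-proper = ProperMap-transfer (splitAtIso G H ⁻¹ᴵ) (proper (proj₁ dc))

  ⊎-coloring-distinguishing : DistinguishingMap (⊎adj (adj G) (adj H)) ⊎-coloring
  ⊎-coloring-distinguishing =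
    DistinguishingMap-transfer (splitAtIso G H ⁻¹ᴵ) (DistColoring⇒DistinguishingMap dc)

no-distColoring-∪-below-χD : ∀ {G H k m} → IsChiD G k → m < k → ¬ DistColoring (G ∪ H) m
no-distColoring-∪-below-χD χ m<k dc = <⇒≱ m<k (χD-≤ χ (⊎-coloring dc ∘ inj₁)
  (λ u v → ⊎-coloring-proper dc (inj₁ u) (inj₁ v))
  (DistinguishingMap-inj₁ (⊎-coloring-distinguishing dc)))

no-distColoring-∪-at-χD : ∀ {G k} → Type1 G → IsChiD G k → ¬ DistColoring (G ∪ G) k
no-distColoring-∪-at-χD {G} {k} ((size≥1 , _) , _ , relabel) χ dc
  with relabel k χ (toDistColoring D₁ (χD-surjective χ D₁ proper₁ dist₁) proper₁ dist₁)
                   (toDistColoring D₂ (χD-surjective χ D₂ proper₂ dist₂) proper₂ dist₂)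
  where
  D₁ D₂ : Fin (size G) → Fin k
  D₁ = ⊎-coloring dc ∘ inj₁
  D₂ = ⊎-coloring dc ∘ inj₂
  proper₁ : ProperMap (adj G) D₁
  proper₁ u v = ⊎-coloring-proper dc (inj₁ u) (inj₁ v)
  proper₂ : ProperMap (adj G) D₂
  proper₂ u v = ⊎-coloring-proper dc (inj₂ u) (inj₂ v)
  dist₁ : DistinguishingMap (adj G) D₁
  dist₁ = DistinguishingMap-inj₁ (⊎-coloring-distinguishing dc)
  dist₂ : DistinguishingMap (adj G) D₂
  dist₂ = DistinguishingMap-inj₂ (⊎-coloring-distinguishing dc)
... | φ , twin = twins-not-distinguishing (fromℕ< size≥1) (Automorphism⇒Aut φ) twin
                   (⊎-coloring-distinguishing dc)

lemma3p4 : (G : Graph) → Type1 G → (k : ℕ) → IsChiD G k → IsChiD (G ∪ G) (suc k)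
lemma3p4 G type1@(connected , _) k χ@(c , _) =
  distColoring-∪ connected c c ,
  λ m m<1+k → [ no-distColoring-∪-below-χD χ , (λ { refl → no-distColoring-∪-at-χD type1 χ }) ]′
                (m<1+n⇒m<n∨m≡n m<1+k)
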